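{- The graph $G_{12}$ is not $\cup$-semi-weakly CIS; that is, neither $G_{12}$ nor its complement $\overline{G_{12}}$ is semi-weakly CIS.
   Context: $G_{12}$ is the graph on vertex set $\{1,\dots,12\}$ in which two distinct vertices are adjacent iff they lie together in some member of $\{\{1,4,7\},\{2,4,5,6\},\{2,4,6,7\},\{2,4,6,9\},\{2,4,9,12\},\{2,5,8\},\{2,6,7,11\},\{2,11,12\},\{3,6,9\},\{4,5,6,10\},\{4,10,12\},\{6,10,11\},\{10,11,12\}\}$ (these are exactly its maximal cliques); its maximal stable sets are $\{1,2,3,10\},\{1,3,5,11\},\{1,3,5,12\},\{1,3,8,10\},\{1,3,8,11\},\{1,3,8,12\},\{1,5,9,11\},\{1,6,8,12\},\{1,8,9,10\},\{1,8,9,11\},\{3,4,8,11\},\{3,5,7,12\},\{3,7,8,10\},\{3,7,8,12\},\{5,7,9\},\{7,8,9,10\}$. A strong clique is a clique meeting every maximal stable set. A graph is semi-weakly CIS if it admits a family of strong cliques such that every two adjacent vertices lie together in some member of the family. -}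

module Defs where

open import Data.Nat using (ℕ; suc; _≡ᵇ_)
open import Data.Fin using (Fin; toℕ)
open import Data.Fin.Subset using (Subset; _∈_; _∉_)
open import Data.Bool using (Bool; true; false; not; _∧_; T)
open import Data.Bool.ListAction using (any)
open import Data.List using (List; []; _∷_)
open import Data.List.Membership.Propositional using () renaming (_∈_ to _∈ₗ_)
open import Data.Product using (_×_; ∃-syntax)
open import Relation.Binary.PropositionalEquality using (_≢_)
open import Relation.Nullary using (¬_)

-- A (simple, finite) graph on vertex set Fin n, given by a Boolean
-- adjacency test; only its values on distinct pairs matter.
Graph : ℕ → Set
Graph n = Fin n → Fin n → Bool

Adj : ∀ {n} → Graph n → Fin n → Fin n → Set
Adj G u v = (u ≢ v) × T (G u v)

complement : ∀ {n} → Graph n → Graph n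
complement G u v = not (G u v)

IsClique : ∀ {n} → Graph n → Subset n → Set
IsClique G C = ∀ u v → u ∈ C → v ∈ C → u ≢ v → Adj G u v

IsStable : ∀ {n} → Graph n → Subset n → Set
IsStable G S = ∀ u v → u ∈ S → v ∈ S → ¬ Adj G u v

IsMaximalStable : ∀ {n} → Graph n → Subset n → Set
IsMaximalStable G S =
  IsStable G S × (∀ w → w ∉ S → ∃[ u ] (u ∈ S × Adj G w u))

IsStrongClique : ∀ {n} → Graph n → Subset n → Set
IsStrongClique G C =
  IsClique G C × (∀ S → IsMaximalStable G S → ∃[ v ] (v ∈ C × v ∈ S))

SemiWeaklyCIS : ∀ {n} → Graph n → Set
SemiWeaklyCIS {n} G =
  ∃[ 𝓕 ] ((∀ C → C ∈ₗ 𝓕 → IsStrongClique G C)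
         × (∀ u v → Adj G u v → ∃[ C ] (C ∈ₗ 𝓕 × u ∈ C × v ∈ C)))

-- The graph G₁₂: vertex i : Fin 12 stands for label toℕ i + 1.
G12-cliques : List (List ℕ)
G12-cliques =
    (1 ∷ 4 ∷ 7 ∷ [])
  ∷ (2 ∷ 4 ∷ 5 ∷ 6 ∷ [])
  ∷ (2 ∷ 4 ∷ 6 ∷ 7 ∷ [])
  ∷ (2 ∷ 4 ∷ 6 ∷ 9 ∷ [])
  ∷ (2 ∷ 4 ∷ 9 ∷ 12 ∷ [])
  ∷ (2 ∷ 5 ∷ 8 ∷ [])
  ∷ (2 ∷ 6 ∷ 7 ∷ 11 ∷ [])
  ∷ (2 ∷ 11 ∷ 12 ∷ [])
  ∷ (3 ∷ 6 ∷ 9 ∷ [])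
  ∷ (4 ∷ 5 ∷ 6 ∷ 10 ∷ [])
  ∷ (4 ∷ 10 ∷ 12 ∷ [])
  ∷ (6 ∷ 10 ∷ 11 ∷ [])
  ∷ (10 ∷ 11 ∷ 12 ∷ [])
  ∷ []

memℕ : ℕ → List ℕ → Bool
memℕ x = any (x ≡ᵇ_)

label : Fin 12 → ℕ
label i = suc (toℕ i)

G12 : Graph 12
G12 u v = any (λ K → memℕ (label u) K ∧ memℕ (label v) K) G12-cliques

-- If an edge uw of a graph G lies in a strong clique C, then C
-- meets every maximal stable set S, say in v; being in the clique C,
-- the vertex v equals or is adjacent to each of u and w.  Hence a
-- maximal stable set S none of whose vertices is "close" (equal or
-- adjacent) to both u and w certifies that uw lies in no strong clique,
-- so no family of strong cliques covers the edges of G.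
--
-- The theorem follows by exhibiting one
-- obstruction for G₁₂ (edge 2–4, stable set {1,3,8,10}) and one for its
-- complement (edge 1–5, stable set {2,4,6,7}, a maximal clique of G₁₂).
module Submission where

open import Defs
open import Data.Nat using (ℕ)
open import Data.Empty using (⊥)
open import Data.Product using (_×_; _,_; ∃-syntax)
open import Relation.Nullary using (¬_; Dec)
open import Relation.Nullary.Decidable using (¬?; _×-dec_; _→-dec_; toWitness)
open import Data.Fin using (Fin; _≟_; #_)
open import Data.Fin.Subset using (Subset; _∈_; ⁅_⁆; _∪_)
open import Data.Fin.Subset.Properties using (_∈?_)
open import Data.Fin.Properties using (all?; any?)
open import Data.Bool.Properties using (T?)
open import Relation.Binary.PropositionalEquality using (_≢_)

module _ {n : ℕ} (G : Graph n) where

  -- v is close to u when v is u itself or a neighbour of u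
  -- (stated without case distinction, so that it is decidable and
  -- follows directly from clique membership).
  CloseTo : Fin n → Fin n → Set
  CloseTo u v = u ≢ v → Adj G u v

  Separates : Fin n → Fin n → Subset n → Set
  Separates u w S = ∀ v → v ∈ S → ¬ (CloseTo u v × CloseTo w v)

  strongClique-meets-close : ∀ {C S u w} → IsStrongClique G C →
    IsMaximalStable G S → u ∈ C → w ∈ C →
    ∃[ v ] (v ∈ S × CloseTo u v × CloseTo w v)
  strongClique-meets-close {_} {S} {u} {w} (clique , meets) maximal u∈C w∈C
    with meets S maximal
  ... | v , v∈C , v∈S = v , v∈S , clique u v u∈C v∈C , clique w v w∈C v∈C

  record Obstruction : Set where
    field
      u w       : Fin n
      edge      : Adj G u w
      S         : Subset n
      maximal   : IsMaximalStable G S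
      separated : Separates u w S

  open Obstruction

  obstruction-edge-in-no-strongClique : (ob : Obstruction) → ∀ {C} →
    IsStrongClique G C → u ob ∈ C → w ob ∈ C → ⊥
  obstruction-edge-in-no-strongClique ob strong u∈C w∈C
    with strongClique-meets-close strong (maximal ob) u∈C w∈C
  ... | v , v∈S , close = separated ob v v∈S close

  obstruction⇒¬SemiWeaklyCIS : Obstruction → ¬ SemiWeaklyCIS G
  obstruction⇒¬SemiWeaklyCIS ob (𝓕 , strong , covers)
    with covers (u ob) (w ob) (edge ob)
  ... | C , C∈𝓕 , u∈C , w∈C =
    obstruction-edge-in-no-strongClique ob (strong C C∈𝓕) u∈C w∈C

  adj? : ∀ u v → Dec (Adj G u v)
  adj? u v = ¬? (u ≟ v) ×-dec T? (G u v)

  isStable? : ∀ S → Dec (IsStable G S)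
  isStable? S = all? λ u → all? λ v →
    (u ∈? S) →-dec (v ∈? S) →-dec ¬? (adj? u v)

  isMaximalStable? : ∀ S → Dec (IsMaximalStable G S)
  isMaximalStable? S = isStable? S ×-dec
    (all? λ w → ¬? (w ∈? S) →-dec any? λ u → (u ∈? S) ×-dec adj? w u)

  closeTo? : ∀ u v → Dec (CloseTo u v)
  closeTo? u v = ¬? (u ≟ v) →-dec adj? u v

  separates? : ∀ u w S → Dec (Separates u w S)
  separates? u w S = all? λ v →
    (v ∈? S) →-dec ¬? (closeTo? u v ×-dec closeTo? w v)

-- Vertex # i of G₁₂ carries label i + 1.

-- In G₁₂ the edge 2–4 is separated by the maximal stable set {1,3,8,10}:
-- the common neighbours 5, 6, 7, 9, 12 of 2 and 4 all lie outside it.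
G12-obstruction : Obstruction G12
G12-obstruction = record
  { u         = # 1
  ; w         = # 3
  ; edge      = toWitness {a? = adj? G12 (# 1) (# 3)} _
  ; S         = S
  ; maximal   = toWitness {a? = isMaximalStable? G12 S} _
  ; separated = toWitness {a? = separates? G12 (# 1) (# 3) S} _
  }
  where
  S : Subset 12
  S = ⁅ # 0 ⁆ ∪ ⁅ # 2 ⁆ ∪ ⁅ # 7 ⁆ ∪ ⁅ # 9 ⁆

-- In the complement, 1–5 is an edge, and the maximal clique {2,4,6,7} of
-- G₁₂ is a maximal stable set each of whose vertices is a G₁₂-neighbour
-- of 1 or of 5.
complement-obstruction : Obstruction (complement G12)
complement-obstruction = record
  { u         = # 0
  ; w         = # 4
  ; edge      = toWitness {a? = adj? Ḡ (# 0) (# 4)} _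
  ; S         = S
  ; maximal   = toWitness {a? = isMaximalStable? Ḡ S} _
  ; separated = toWitness {a? = separates? Ḡ (# 0) (# 4) S} _
  }
  where
  Ḡ : Graph 12
  Ḡ = complement G12
  S : Subset 12
  S = ⁅ # 1 ⁆ ∪ ⁅ # 3 ⁆ ∪ ⁅ # 5 ⁆ ∪ ⁅ # 6 ⁆

proposition35 : ¬ SemiWeaklyCIS G12 × ¬ SemiWeaklyCIS (complement G12)
proposition35 =
    obstruction⇒¬SemiWeaklyCIS G12 G12-obstruction
  , obstruction⇒¬SemiWeaklyCIS (complement G12) complement-obstruction
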